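{- Let $\mu$ be a repeating path whose set of positions has at most $N^2+1$ elements. Then for every $k\ge1$, the power $\mu^k$ has no subpath that is a long corner.
   Context: Let $R(\mathbf{x},\mathbf{x}')$ be a difference bounds constraint over $\mathbf{x}=\{x_1,\dots,x_N\}$ (a finite conjunction of atoms $u-v\le c$, $c\in\mathbb{Z}$, with constraint graph having an edge $u\xrightarrow{c}v$ per atom). With fresh copies $x_i^{(p)}$, $p\in\mathbb{Z}$ (position $p$), the bi-infinite unfolding is the union over all $p$ of the constraint graphs of $R(\mathbf{x}^{(p)},\mathbf{x}^{(p+1)})$; all paths are in it. A path $x_{i_0}^{(p_0)}\to\cdots\to x_{i_m}^{(p_m)}$ is repeating if $p_0\ne p_m$ and $i_0=i_m$. For a repeating path $\mu$ and $k\ge1$, $\mu^k$ is the concatenation of $\mu$ with $k-1$ shifted copies of itself, each copy shifted (all positions increased by the same integer) so that it starts at the last vertex of the previous one. A corner is a path with at least one edge whose first and last vertex have the same position $k_0$ and whose positions form $\{k_0,\dots,k_0+d\}$ or $\{k_0-d,\dots,k_0\}$; it is long if $d>N^2$. -}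

module Defs where

open import Data.Nat using (ℕ; zero; suc; _*_; _<_; _≤_)
open import Data.Integer as ℤ using (ℤ; +_)
open import Data.Fin using (Fin)
open import Data.Sum using (_⊎_; inj₁; inj₂)
open import Data.Product using (Σ; ∃; _×_; _,_; proj₁; proj₂)
open import Data.List using (List; []; _∷_; _++_; map; length; deduplicate)
open import Data.List.Membership.Propositional using (_∈_)
open import Data.List.Relation.Unary.Linked using (Linked)
open import Data.Empty using (⊥)
open import Relation.Binary.PropositionalEquality using (_≡_)

-- Variables of R(x, x'): inj₁ i is x_i (unprimed), inj₂ i is x_i' (primed).
Var : ℕ → Set
Var N = Fin N ⊎ Fin N

-- An atom  u - v ≤ c ; its constraint-graph edge is  u --c--> v.
record Atom (N : ℕ) : Set where
  constructor atom
  field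
    u : Var N
    v : Var N
    c : ℤ

-- A difference bounds constraint: a finite conjunction of atoms.
DBC : ℕ → Set
DBC N = List (Atom N)

lastOf : ∀ {A : Set} → A → List A → A
lastOf x [] = x
lastOf x (y ∷ ys) = lastOf y ys

-- Vertices of the bi-infinite unfolding: x_i^(p).
Vertex : ℕ → Set
Vertex N = Fin N × ℤ

var : ∀ {N} → Vertex N → Fin N
var = proj₁

pos : ∀ {N} → Vertex N → ℤ
pos = proj₂

-- Placement of R(x^(p), x^(p+1)): x ↦ x^(p), x' ↦ x^(p+1).
place : ∀ {N} → ℤ → Var N → Vertex N
place p (inj₁ i) = i , p
place p (inj₂ i) = i , p ℤ.+ + 1

-- Edge of the unfolding (the union over p of the graphs of R(x^(p),x^(p+1))),
-- carrying its weight c.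
Edge : ∀ {N} → DBC N → Vertex N → ℤ → Vertex N → Set
Edge R x c y = Σ (Atom _) λ a → a ∈ R × Σ ℤ λ p →
  place p (Atom.u a) ≡ x × place p (Atom.v a) ≡ y × Atom.c a ≡ c

Adj : ∀ {N} → DBC N → Vertex N → Vertex N → Set
Adj R x y = ∃ λ c → Edge R x c y

-- A path in the unfolding, given by its vertex sequence start ∷ rest
-- (rest may be empty: a path with no edges).
record Path {N : ℕ} (R : DBC N) : Set where
  constructor path
  field
    start  : Vertex N
    rest   : List (Vertex N)
    linked : Linked (Adj R) (start ∷ rest)

  verts : List (Vertex N)
  verts = start ∷ rest

  final : Vertex N
  final = lastOf start rest

open Path public

Repeating : ∀ {N} {R : DBC N} → Path R → Set
Repeating μ = (pos (start μ) ≡ pos (final μ) → ⊥) × var (start μ) ≡ var (final μ)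

numPositions : ∀ {N} {R : DBC N} → Path R → ℕ
numPositions μ = length (deduplicate ℤ._≟_ (map pos (verts μ)))

shift : ∀ {N} → ℤ → Vertex N → Vertex N
shift d (i , p) = i , p ℤ.+ d

-- Vertex sequence of μ^k : μ followed by k-1 shifted copies, the j-th copy
-- (j = 1..k-1) shifted by j·δ with δ = pos(last) - pos(first), so that it starts
-- at the last vertex of the previous copy (for repeating μ). The first vertex of
-- each copy is dropped since it coincides with the last vertex of the previous one.
-- (powerVerts μ 0 is the single start vertex; only k ≥ 1 is used.)
powerVerts : ∀ {N} {R : DBC N} → Path R → ℕ → List (Vertex N)
powerVerts μ zero = start μ ∷ []
powerVerts μ (suc zero) = verts μ
powerVerts μ (suc (suc k)) =
  powerVerts μ (suc k) ++ map (shift (+ (suc k) ℤ.* δ)) (rest μ)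
  where
  δ : ℤ
  δ = pos (final μ) ℤ.- pos (start μ)

IntervalUp : ℤ → ℕ → List ℤ → Set
IntervalUp k0 d ps = ∀ q → (q ∈ ps → k0 ℤ.≤ q × q ℤ.≤ k0 ℤ.+ + d)
                          × (k0 ℤ.≤ q × q ℤ.≤ k0 ℤ.+ + d → q ∈ ps)

IntervalDown : ℤ → ℕ → List ℤ → Set
IntervalDown k0 d ps = ∀ q → (q ∈ ps → k0 ℤ.- + d ℤ.≤ q × q ℤ.≤ k0)
                            × (k0 ℤ.- + d ℤ.≤ q × q ℤ.≤ k0 → q ∈ ps)

CornerOfWidth : ∀ {N} → List (Vertex N) → ℕ → Set
CornerOfWidth [] d = ⊥
CornerOfWidth (x ∷ []) d = ⊥
CornerOfWidth (x ∷ y ∷ ys) d =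
  pos (lastOf y ys) ≡ pos x
  × (IntervalUp (pos x) d (map pos (x ∷ y ∷ ys)) ⊎ IntervalDown (pos x) d (map pos (x ∷ y ∷ ys)))

LongCorner : ∀ N → List (Vertex N) → Set
LongCorner N seg = Σ ℕ λ d → N * N < d × CornerOfWidth seg d

SubpathOf : ∀ {A : Set} → List A → List A → Set
SubpathOf seg vs = Σ _ λ xs → Σ _ λ ys → vs ≡ xs ++ seg ++ ys

module Submission where

-- Let P be the list of positions of μ and δ = pos(last) - pos(first).
-- Every position on μ^k has the form s + i·δ with s ∈ P, where i is the index of the copy
-- of μ it lies on, and copy indices never decrease along μ^k.  Hence if δ ≥ 0 a later
-- vertex of μ^k can lie below an earlier one by at most a drop occurring inside P, and
-- symmetrically if δ ≤ 0 it can lie above an earlier one by at most a rise inside P.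
-- Consecutive positions of a path differ by at most one, so P covers every integer between
-- two of its values; a drop or rise of d inside P therefore forces d + 1 distinct positions.
-- A corner of width d starts and ends at k₀ and passes through k₀ ± d, so it contains both
-- a rise and a drop of d; whichever sign δ has, one of them yields d + 1 ≤ N² + 1.

open import Defs
open import Data.Nat using (ℕ; _*_; _+_; _≤_)
open import Relation.Nullary using (¬_)
open import Data.List using (List)

open import Data.Nat using (zero; suc; z≤n; s≤s)
import Data.Nat.Properties as ℕP
open import Data.Integer as ℤ using (ℤ; +_; -[1+_]; +≤+; +<+)
import Data.Integer.Properties as ℤP
open import Data.Integer.Tactic.RingSolver using (solve-∀)
open import Data.List using ([]; _∷_; _++_; map; length)
open import Data.List.Properties using (length-++-sucʳ; map-++)
open import Data.List.Membership.Propositional using (_∈_)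
open import Data.List.Membership.Propositional.Properties
  using (∈-∃++; ∈-++⁻; ∈-++⁺ˡ; ∈-++⁺ʳ; ∈-deduplicate⁺)
open import Data.List.Relation.Unary.Any using (here; there)
open import Data.List.Relation.Unary.All using (All; []; _∷_)
import Data.List.Relation.Unary.All as All
import Data.List.Relation.Unary.All.Properties as AllP
open import Data.List.Relation.Unary.AllPairs using (AllPairs; []; _∷_)
import Data.List.Relation.Unary.AllPairs.Properties as AllPairsP
open import Data.List.Relation.Unary.Linked using (Linked; _∷_)
import Data.List.Relation.Unary.Linked as Linked
import Data.List.Relation.Unary.Linked.Properties as LinkedP
open import Data.Product using (∃; _×_; _,_; proj₁; proj₂)
open import Data.Sum using (_⊎_; inj₁; inj₂)
open import Data.Empty using (⊥-elim)
open import Level using (0ℓ)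
open import Relation.Binary.Core using (Rel)
open import Relation.Binary.Definitions using (Reflexive)
open import Relation.Nullary using (yes; no)
open import Relation.Binary.PropositionalEquality

lastOf∈ : ∀ {A : Set} (a : A) l → lastOf a l ∈ a ∷ l
lastOf∈ a [] = here refl
lastOf∈ a (b ∷ l) = there (lastOf∈ b l)

lastOf-map : ∀ {A B : Set} (f : A → B) a l → f (lastOf a l) ≡ lastOf (f a) (map f l)
lastOf-map f a [] = refl
lastOf-map f a (b ∷ l) = lastOf-map f b l

module _ {A : Set} {R : Rel A 0ℓ} where

  head-related : Reflexive R → ∀ {a l z} → AllPairs R (a ∷ l) → z ∈ a ∷ l → R a z
  head-related r _ (here refl) = r
  head-related r (ra ∷ _) (there z∈) = All.lookup ra z∈

  related-last : Reflexive R → ∀ {a l z} → AllPairs R (a ∷ l) → z ∈ a ∷ l → R z (lastOf a l)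
  related-last r {l = []} _ (here refl) = r
  related-last r {l = b ∷ l} (ra ∷ _) (here refl) = All.lookup ra (lastOf∈ b l)
  related-last r {l = b ∷ l} (_ ∷ rs) (there z∈) = related-last r rs z∈

  allPairs-++ˡ : ∀ xs {ys} → AllPairs R (xs ++ ys) → AllPairs R xs
  allPairs-++ˡ [] _ = []
  allPairs-++ˡ (x ∷ xs) (rx ∷ rs) = AllP.++⁻ˡ xs rx ∷ allPairs-++ˡ xs rs

  allPairs-++ʳ : ∀ xs {ys} → AllPairs R (xs ++ ys) → AllPairs R ys
  allPairs-++ʳ [] rs = rs
  allPairs-++ʳ (x ∷ xs) (_ ∷ rs) = allPairs-++ʳ xs rs

  allPairs-infix : ∀ xs ys {zs} → AllPairs R (xs ++ ys ++ zs) → AllPairs R ys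
  allPairs-infix xs ys rs = allPairs-++ˡ ys (allPairs-++ʳ xs rs)

  allPairs-from-All : ∀ {Q : A → Set} → (∀ {x y} → Q x → Q y → R x y) →
                      ∀ {l} → All Q l → AllPairs R l
  allPairs-from-All rel [] = []
  allPairs-from-All rel (qx ∷ qs) = All.map (rel qx) qs ∷ allPairs-from-All rel qs

Step : ℤ → ℤ → Set
Step a b = b ℤ.≤ ℤ.suc a × a ℤ.≤ ℤ.suc b

suc-cancel-≤ : ∀ {a b} → ℤ.suc a ℤ.≤ ℤ.suc b → a ℤ.≤ b
suc-cancel-≤ {a} {b} p = subst₂ ℤ._≤_ (ℤP.pred-suc a) (ℤP.pred-suc b) (ℤP.pred-mono p)

between-head : ∀ {q z} a l → Linked Step (a ∷ l) → z ∈ a ∷ l →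
               (a ℤ.≤ q × q ℤ.≤ z) ⊎ (z ℤ.≤ q × q ℤ.≤ a) → q ∈ a ∷ l
between-head a l _ (here refl) (inj₁ (a≤q , q≤a)) = here (ℤP.≤-antisym q≤a a≤q)
between-head a l _ (here refl) (inj₂ (a≤q , q≤a)) = here (ℤP.≤-antisym q≤a a≤q)
between-head {q} a (b ∷ l) (step ∷ steps) (there z∈) between with q ℤ.≟ a
... | yes q≡a = here q≡a
... | no q≢a = there (between-head b l steps z∈ (narrow between))
  where
  -- q lies strictly beyond a, so it still lies between b and z.
  narrow : (a ℤ.≤ q × q ℤ.≤ _) ⊎ (_ ℤ.≤ q × q ℤ.≤ a) → (b ℤ.≤ q × q ℤ.≤ _) ⊎ (_ ℤ.≤ q × q ℤ.≤ b)
  narrow (inj₁ (a≤q , q≤z)) =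
    inj₁ (ℤP.≤-trans (proj₁ step) (ℤP.i<j⇒suc[i]≤j (ℤP.≤∧≢⇒< a≤q (λ a≡q → q≢a (sym a≡q)))) , q≤z)
  narrow (inj₂ (z≤q , q≤a)) =
    inj₂ (z≤q , suc-cancel-≤ (ℤP.≤-trans (ℤP.i<j⇒suc[i]≤j (ℤP.≤∧≢⇒< q≤a q≢a)) (proj₂ step)))

intermediate-value : ∀ {q x y} l → Linked Step l → x ∈ l → y ∈ l → x ℤ.≤ q → q ℤ.≤ y → q ∈ l
intermediate-value (a ∷ l) steps (here refl) y∈ x≤q q≤y = between-head a l steps y∈ (inj₁ (x≤q , q≤y))
intermediate-value (a ∷ l) steps (there x∈) (here refl) x≤q q≤y =
  between-head a l steps (there x∈) (inj₂ (x≤q , q≤y))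
intermediate-value (a ∷ []) _ (there ()) (there _) _ _
intermediate-value (a ∷ b ∷ l) (_ ∷ steps) (there x∈) (there y∈) x≤q q≤y =
  there (intermediate-value (b ∷ l) steps x∈ y∈ x≤q q≤y)

interval-length : ∀ (lo : ℤ) d (L : List ℤ) → (∀ t → t ≤ d → lo ℤ.+ + t ∈ L) → suc d ≤ length L
interval-length lo zero L covers with covers 0 z≤n
... | here _ = s≤s z≤n
... | there _ = s≤s z≤n
interval-length lo (suc d) L covers with ∈-∃++ (covers (suc d) ℕP.≤-refl)
... | L₁ , L₂ , refl =
  subst (suc (suc d) ≤_) (sym (length-++-sucʳ L₁ (lo ℤ.+ + suc d) L₂))
        (s≤s (interval-length lo d (L₁ ++ L₂) covers-rest))
  where
  covers-rest : ∀ t → t ≤ d → lo ℤ.+ + t ∈ L₁ ++ L₂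
  covers-rest t t≤d with ∈-++⁻ L₁ (covers t (ℕP.m≤n⇒m≤1+n t≤d))
  ... | inj₁ p = ∈-++⁺ˡ p
  ... | inj₂ (here eq) = ⊥-elim (ℤP.<-irrefl eq (ℤP.+-monoʳ-< lo (+<+ (s≤s t≤d))))
  ... | inj₂ (there p) = ∈-++⁺ʳ L₁ p

unshift : ∀ {x y : ℤ} s t d → x ℤ.≤ y → (t ℤ.+ y) ℤ.+ + d ℤ.≤ s ℤ.+ x → t ℤ.+ + d ℤ.≤ s
unshift {x} {y} s t d x≤y h = begin
  t ℤ.+ + d                       ≡⟨ regroup t y (+ d) ⟩
  ((t ℤ.+ y) ℤ.+ + d) ℤ.- y       ≤⟨ ℤP.+-monoˡ-≤ (ℤ.- y) h ⟩
  (s ℤ.+ x) ℤ.- y                 ≤⟨ ℤP.+-monoˡ-≤ (ℤ.- y) (ℤP.+-monoʳ-≤ s x≤y) ⟩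
  (s ℤ.+ y) ℤ.- y                 ≡⟨ cancel s y ⟩
  s                               ∎
  where
  open ℤP.≤-Reasoning
  regroup : ∀ (t y e : ℤ) → t ℤ.+ e ≡ ((t ℤ.+ y) ℤ.+ e) ℤ.- y
  regroup = solve-∀
  cancel : ∀ (s y : ℤ) → (s ℤ.+ y) ℤ.- y ≡ s
  cancel = solve-∀

place-step : ∀ {N} p (u v : Var N) → Step (pos (place p u)) (pos (place p v))
place-step p (inj₁ _) (inj₁ _) = ℤP.i≤suc[i] p , ℤP.i≤suc[i] p
place-step p (inj₁ _) (inj₂ _) =
  ℤP.≤-reflexive (ℤP.+-comm p (+ 1)) , ℤP.≤-trans (ℤP.i≤i+j p (+ 1)) (ℤP.i≤suc[i] _)
place-step p (inj₂ _) (inj₁ _) =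
  ℤP.≤-trans (ℤP.i≤i+j p (+ 1)) (ℤP.i≤suc[i] _) , ℤP.≤-reflexive (ℤP.+-comm p (+ 1))
place-step p (inj₂ _) (inj₂ _) = ℤP.i≤suc[i] _ , ℤP.i≤suc[i] _

adj-step : ∀ {N} {R : DBC N} {x y} → Adj R x y → Step (pos x) (pos y)
adj-step (_ , a , _ , p , refl , refl , _) = place-step p (Atom.u a) (Atom.v a)

-- The direction in which successive copies of μ move inside μ^k.
data Direction : Set where
  upward downward : Direction

direction : ℤ → Direction
direction (+ _) = upward
direction -[1+ _ ] = downward

module Power {N} {R : DBC N} (μ : Path R) where

  P : List ℤ
  P = map pos (verts μ)

  δ : ℤ
  δ = pos (final μ) ℤ.- pos (start μ)

  -- Positions of μ^(k+1).
  positions : ℕ → List ℤ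
  positions k = map pos (powerVerts μ (suc k))

  P-steps : Linked Step P
  P-steps = LinkedP.map⁺ (Linked.map adj-step (linked μ))

  gap-bound : ∀ {s t} d → s ∈ P → t ∈ P → s ℤ.+ + d ℤ.≤ t → suc d ≤ numPositions μ
  gap-bound {s} d s∈ t∈ s+d≤t = interval-length s d _ λ i i≤d →
    ∈-deduplicate⁺ ℤ._≟_ (intermediate-value P P-steps s∈ t∈ (ℤP.i≤i+j s (+ i))
      (ℤP.≤-trans (ℤP.+-monoʳ-≤ s (+≤+ i≤d)) s+d≤t))

  BoundedDrop : ℤ → ℤ → Set
  BoundedDrop a b = ∀ d → b ℤ.+ + d ℤ.≤ a → suc d ≤ numPositions μ

  boundedDrop-refl : Reflexive BoundedDrop
  boundedDrop-refl {a} d a+d≤a = gap-bound d s∈ s∈ (unshift {a} {a} s₀ s₀ d ℤP.≤-refl s+a+d≤s+a)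
    where
    s₀ : ℤ
    s₀ = pos (start μ)
    s∈ : s₀ ∈ P
    s∈ = here refl
    s+a+d≤s+a : (s₀ ℤ.+ a) ℤ.+ + d ℤ.≤ s₀ ℤ.+ a
    s+a+d≤s+a = subst (ℤ._≤ _) (sym (ℤP.+-assoc s₀ a (+ d))) (ℤP.+-monoʳ-≤ s₀ a+d≤a)

  -- "b may follow a along μ^k": when copies move upward a later position can only drop
  -- boundedly below an earlier one, when they move downward it can only rise boundedly.
  Follows : Direction → ℤ → ℤ → Set
  Follows upward a b = BoundedDrop a b
  Follows downward a b = BoundedDrop b a

  follows-refl : ∀ o → Reflexive (Follows o)
  follows-refl upward = boundedDrop-refl
  follows-refl downward = boundedDrop-refl

  follows-both : ∀ o {a b} → Follows o a b → Follows o b a → BoundedDrop a b × BoundedDrop b a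
  follows-both upward ab ba = ab , ba
  follows-both downward ab ba = ba , ab

  Copy : ℕ → ℤ → Set
  Copy i v = ∃ λ s → s ∈ P × v ≡ s ℤ.+ + i ℤ.* δ

  -- Key estimate: a point on copy j follows a point on an earlier copy i ≤ j.  The shifts
  -- i·e ≤ j·e (e ≥ 0) or j·e ≤ i·e (e < 0) cancel and leave a drop inside P.
  shifted-follows : ∀ e {s t i j} → s ∈ P → t ∈ P → i ≤ j →
                    Follows (direction e) (s ℤ.+ + i ℤ.* e) (t ℤ.+ + j ℤ.* e)
  shifted-follows (+ n) {s} {t} s∈ t∈ i≤j d drop =
    gap-bound d t∈ s∈ (unshift s t d (ℤP.*-monoʳ-≤-nonNeg (+ n) (+≤+ i≤j)) drop)
  shifted-follows -[1+ n ] {s} {t} s∈ t∈ i≤j d rise =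
    gap-bound d s∈ t∈ (unshift t s d (ℤP.*-monoʳ-≤-nonPos -[1+ n ] (+≤+ i≤j)) rise)

  copies-follow : ∀ {i j a b} → Copy i a → Copy j b → i ≤ j → Follows (direction δ) a b
  copies-follow (s , s∈ , refl) (t , t∈ , refl) = shifted-follows δ s∈ t∈

  positions-suc : ∀ k → positions (suc k) ≡ positions k ++ map (ℤ._+ + suc k ℤ.* δ) (map pos (rest μ))
  positions-suc k =
    trans (map-++ pos (powerVerts μ (suc k)) _) (cong (positions k ++_) (shifted (rest μ)))
    where
    shifted : ∀ l → map pos (map (shift (+ suc k ℤ.* δ)) l) ≡ map (ℤ._+ + suc k ℤ.* δ) (map pos l)
    shifted [] = refl
    shifted (_ ∷ l) = cong (_ ∷_) (shifted l)

  P-copy : All (Copy 0) P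
  P-copy = All.tabulate λ {s} s∈ → s , s∈ , sym (s+0·δ≡s s)
    where
    s+0·δ≡s : ∀ s → s ℤ.+ + 0 ℤ.* δ ≡ s
    s+0·δ≡s s = trans (cong (λ z → s ℤ.+ z) (ℤP.*-zeroˡ δ)) (ℤP.+-identityʳ s)

  new-copy : ∀ k → All (Copy (suc k)) (map (ℤ._+ + suc k ℤ.* δ) (map pos (rest μ)))
  new-copy k = AllP.map⁺ (All.tabulate λ {p} p∈ → p , there p∈ , refl)

  InCopies : ℕ → ℤ → Set
  InCopies k v = ∃ λ i → i ≤ k × Copy i v

  positions-in-copies : ∀ k → All (InCopies k) (positions k)
  positions-in-copies zero = All.map (λ c → 0 , z≤n , c) P-copy
  positions-in-copies (suc k) rewrite positions-suc k =
    AllP.++⁺ (All.map weaken (positions-in-copies k)) (All.map (λ c → suc k , ℕP.≤-refl , c) (new-copy k))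
    where
    weaken : ∀ {v} → InCopies k v → InCopies (suc k) v
    weaken (i , i≤k , c) = i , ℕP.m≤n⇒m≤1+n i≤k , c

  -- Along μ^(k+1) every position follows all earlier ones, since the copies are traversed
  -- in increasing order: the new copy k+1 comes after copies 0, …, k.
  positions-follow : ∀ k → AllPairs (Follows (direction δ)) (positions k)
  positions-follow zero = allPairs-from-All (λ a b → copies-follow {0} {0} a b z≤n) P-copy
  positions-follow (suc k) rewrite positions-suc k =
    AllPairsP.++⁺ (positions-follow k) new-pairs (All.map follows-new (positions-in-copies k))
    where
    new = map (ℤ._+ + suc k ℤ.* δ) (map pos (rest μ))
    new-pairs : AllPairs (Follows (direction δ)) new
    new-pairs = allPairs-from-All (λ a b → copies-follow {suc k} {suc k} a b ℕP.≤-refl) (new-copy k)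
    follows-new : ∀ {v} → InCopies k v → All (Follows (direction δ) v) new
    follows-new (i , i≤k , a) = All.map (λ b → copies-follow {i} {suc k} a b (ℕP.m≤n⇒m≤1+n i≤k)) (new-copy k)

  -- A corner of width d along μ^k needs d + 1 positions of μ: it contains both a drop and a
  -- rise of d between its common endpoint position and its extreme position.
  corner-bound : ∀ seg d → CornerOfWidth {N} seg d → AllPairs (Follows (direction δ)) (map pos seg) →
                 suc d ≤ numPositions μ
  corner-bound (x ∷ y ∷ ys) d (closed , shape) pairs = bound shape
    where
    closed′ : lastOf (pos y) (map pos ys) ≡ pos x
    closed′ = trans (sym (lastOf-map pos y ys)) closed
    both : ∀ {z} → z ∈ map pos (x ∷ y ∷ ys) → BoundedDrop (pos x) z × BoundedDrop z (pos x)
    both z∈ = follows-both (direction δ)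
      (head-related (follows-refl _) pairs z∈)
      (subst (Follows _ _) closed′ (related-last (follows-refl _) pairs z∈))
    bound : IntervalUp (pos x) d (map pos (x ∷ y ∷ ys)) ⊎ IntervalDown (pos x) d (map pos (x ∷ y ∷ ys))
          → suc d ≤ numPositions μ
    bound (inj₁ up) = proj₂ (both peak∈) d ℤP.≤-refl
      where
      peak∈ = proj₂ (up _) (ℤP.i≤i+j _ (+ d) , ℤP.≤-refl)
    bound (inj₂ down) = proj₁ (both trough∈) d (ℤP.≤-reflexive (minus-plus (pos x) (+ d)))
      where
      trough∈ = proj₂ (down _) (ℤP.≤-refl , ℤP.i-j≤i (pos x) (+ d))
      minus-plus : ∀ (a b : ℤ) → (a ℤ.- b) ℤ.+ b ≡ a
      minus-plus = solve-∀

proposition13 : (N : ℕ) (R : DBC N) (μ : Path R) → Repeating μ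
    → numPositions μ ≤ N * N + 1
    → (k : ℕ) → 1 ≤ k
    → (seg : List (Vertex N)) → SubpathOf seg (powerVerts μ k) → ¬ LongCorner N seg
proposition13 N R μ _ bound (suc k) _ seg (xs , ys , μᵏ≡) (d , N²<d , corner) =
  ℕP.<⇒≱ N²<d (ℕP.≤-pred (subst (suc d ≤_) (ℕP.+-comm (N * N) 1) width-bound))
  where
  open Power μ
  split : positions k ≡ map pos xs ++ map pos seg ++ map pos ys
  split = trans (cong (map pos) μᵏ≡)
    (trans (map-++ pos xs (seg ++ ys)) (cong (map pos xs ++_) (map-++ pos seg ys)))
  seg-follows : AllPairs (Follows (direction δ)) (map pos seg)
  seg-follows = allPairs-infix (map pos xs) (map pos seg)
    (subst (AllPairs _) split (positions-follow k))
  width-bound : suc d ≤ N * N + 1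
  width-bound = ℕP.≤-trans (corner-bound seg d corner seg-follows) bound
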